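{- Let $n,s_1,s_2$ be positive integers with $s_2\geq 2s_1$ and $n\geq 2s_2-2$. Then the independence number of $W(n,s_1,s_2)$ satisfies \[ \alpha\left(W(n,s_1,s_2)\right) = 2s_1 . \]
   Context: For positive integers $n,s_1,s_2$, $W(n,s_1,s_2)$ is the graph with vertex set $[n]=\{1,\dots,n\}$ in which two distinct vertices $i<j$ are adjacent if and only if $s_1\leq j-i\leq n-s_2$. $\alpha(G)$ denotes the maximum size of an independent set of $G$. -}

module Defs where

open import Data.Nat using (ℕ; _≤_; _<_; _∸_)
open import Data.Product using (_×_; Σ-syntax)
open import Relation.Binary.PropositionalEquality using (_≡_)
open import Data.Sum using (_⊎_)
open import Data.List using (List; length)
open import Data.List.Membership.Propositional using (_∈_)
open import Data.List.Relation.Unary.All using (All)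
open import Data.List.Relation.Unary.Unique.Propositional using (Unique)
open import Relation.Nullary using (¬_)

InVertexSet : ℕ → ℕ → Set
InVertexSet n v = 1 ≤ v × v ≤ n

-- For vertices i < j:  i ~ j in W(n,s1,s2) iff s1 ≤ j - i ≤ n - s2
-- (n ∸ s2 is truncated subtraction; since j - i ≥ 1, truncation never creates edges).
W-adjOrd : ℕ → ℕ → ℕ → ℕ → ℕ → Set
W-adjOrd n s₁ s₂ i j = i < j × s₁ ≤ j ∸ i × j ∸ i ≤ n ∸ s₂

W-adj : ℕ → ℕ → ℕ → ℕ → ℕ → Set
W-adj n s₁ s₂ i j = W-adjOrd n s₁ s₂ i j ⊎ W-adjOrd n s₁ s₂ j i

IsIndependent : ℕ → ℕ → ℕ → List ℕ → Set
IsIndependent n s₁ s₂ S =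
  Unique S × All (InVertexSet n) S ×
  (∀ {i j} → i ∈ S → j ∈ S → ¬ W-adj n s₁ s₂ i j)

IndependenceNumberIs : ℕ → ℕ → ℕ → ℕ → Set
IndependenceNumberIs n s₁ s₂ k =
  (Σ[ S ∈ List ℕ ] (IsIndependent n s₁ s₂ S × length S ≡ k)) ×
  (∀ S → IsIndependent n s₁ s₂ S → length S ≤ k)

{-# OPTIONS --safe #-}
module Submission where

-- A set of vertices is independent in W(n,s₁,s₂) exactly when no difference of two of its
-- elements lies in [s₁, d], where d = n - s₂.  For the lower bound, {1,…,s₁} together with
-- {s₁+d+1,…,2s₁+d} works, since 2s₁ ≤ s₂ makes the second block fit into [n].  For the upper
-- bound, n ≥ 2s₂ - 2 says n ≤ 2(d+1), so [n] is covered by two windows of width d+1.  Two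
-- elements of an independent set in the same window differ by at most d, hence by less than s₁,
-- and a duplicate-free set of naturals of diameter less than s₁ has at most s₁ elements.

open import Defs
open import Data.Nat using (ℕ; _≤_; _*_; _∸_)
open import Data.Nat using (suc; _+_; _<_; z≤n; s≤s; s≤s⁻¹; _<?_)
open import Data.Nat.Properties
open import Data.Nat.Tactic.RingSolver using (solve-∀)
open import Data.Product using (_×_; _,_; proj₁; proj₂)
open import Data.Sum as Sum using (_⊎_; inj₁; inj₂; [_,_]; [_,_]′)
open import Data.List using (List; []; _∷_; _++_; length; filter; applyUpTo)
open import Data.List.Properties using (length-++; length-applyUpTo; length-removeAt′)
open import Data.List.Extrema.Nat using (min; min≤⊤; min≤xs; argmin-sel)
open import Data.List.Membership.Propositional using (_∈_; _─_)
open import Data.List.Membership.Propositional.Properties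
  using (∈-filter⁻; ∈-++⁻; ∈-applyUpTo⁺; ∈-applyUpTo⁻)
open import Data.List.Relation.Binary.Subset.Propositional using (_⊆_)
open import Data.List.Relation.Unary.All as All using (All)
open import Data.List.Relation.Unary.Any using (here; there; index)
open import Data.List.Relation.Unary.Unique.Propositional using (Unique)
open import Data.List.Relation.Unary.AllPairs using (_∷_)
import Data.List.Relation.Unary.Unique.Propositional.Properties as Unique
open import Relation.Nullary using (¬_; yes; no; Dec; ¬?)
open import Relation.Nullary.Negation using (contradiction)
open import Relation.Binary.PropositionalEquality
  using (_≡_; _≢_; refl; sym; trans; cong; cong₂; subst; ≢-sym; module ≡-Reasoning)
open import Function using (_∘_; id)

module _ {a} {A : Set a} where

  ∈-─⁺ : ∀ {x y} {ys : List A} (x∈ys : x ∈ ys) → y ≢ x → y ∈ ys → y ∈ ys ─ x∈ys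
  ∈-─⁺ (here refl)   y≢x (here refl)   = contradiction refl y≢x
  ∈-─⁺ (here refl)   _   (there y∈ys) = y∈ys
  ∈-─⁺ (there _)     _   (here refl)   = here refl
  ∈-─⁺ (there x∈ys) y≢x (there y∈ys) = there (∈-─⁺ x∈ys y≢x y∈ys)

  unique-⊆⇒length≤ : ∀ {xs ys : List A} → Unique xs → xs ⊆ ys → length xs ≤ length ys
  unique-⊆⇒length≤ {[]} _ _ = z≤n
  unique-⊆⇒length≤ {x ∷ xs} {ys} (x∉xs ∷ unique) xs⊆ys = begin
    suc (length xs)          ≤⟨ s≤s (unique-⊆⇒length≤ unique xs⊆ys─x) ⟩
    suc (length (ys ─ x∈ys)) ≡⟨ length-removeAt′ ys (index x∈ys) ⟨
    length ys                ∎
    where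
    open ≤-Reasoning
    x∈ys : x ∈ ys
    x∈ys = xs⊆ys (here refl)
    xs⊆ys─x : xs ⊆ ys ─ x∈ys
    xs⊆ys─x y∈xs = ∈-─⁺ x∈ys (≢-sym (All.lookup x∉xs y∈xs)) (xs⊆ys (there y∈xs))

  module _ {P : A → Set} (P? : ∀ x → Dec (P x)) where

    length-filter-split : ∀ xs → length (filter P? xs) + length (filter (¬? ∘ P?) xs) ≡ length xs
    length-filter-split [] = refl
    length-filter-split (x ∷ xs) with P? x
    ... | yes _ = cong suc (length-filter-split xs)
    ... | no _  = trans (+-suc _ _) (cong suc (length-filter-split xs))

m+m≡2*m : ∀ m → m + m ≡ 2 * m
m+m≡2*m m = cong (m +_) (sym (+-identityʳ m))

InInterval : ℕ → ℕ → ℕ → Set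
InInterval a k x = a ≤ x × x < a + k

interval : ℕ → ℕ → List ℕ
interval a k = applyUpTo (a +_) k

inInterval⇒∸< : ∀ {a k x} → InInterval a k x → x ∸ a < k
inInterval⇒∸< {a} {k} (a≤x , x<a+k) =
  +-cancelˡ-< a _ k (subst (_< a + k) (sym (m+[n∸m]≡n a≤x)) x<a+k)

∸<⇒inInterval : ∀ {a k x} → a ≤ x → x ∸ a < k → InInterval a k x
∸<⇒inInterval {a} {k} a≤x x∸a<k = a≤x , subst (_< a + k) (m+[n∸m]≡n a≤x) (+-monoʳ-< a x∸a<k)

inInterval-∸< : ∀ {a k x y} → InInterval a k x → InInterval a k y → y ∸ x < k
inInterval-∸< {y = y} (a≤x , _) y∈ = ≤-<-trans (∸-monoʳ-≤ y a≤x) (inInterval⇒∸< y∈)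

∈-interval⁺ : ∀ {a k x} → InInterval a k x → x ∈ interval a k
∈-interval⁺ {a} {k} x∈@(a≤x , _) =
  subst (_∈ interval a k) (m+[n∸m]≡n a≤x) (∈-applyUpTo⁺ (a +_) (inInterval⇒∸< x∈))

∈-interval⁻ : ∀ {a k x} → x ∈ interval a k → InInterval a k x
∈-interval⁻ {a} x∈ with i , i<k , refl ← ∈-applyUpTo⁻ (a +_) x∈ = m≤m+n a i , +-monoʳ-< a i<k

interval-unique : ∀ a k → Unique (interval a k)
interval-unique a k = Unique.applyUpTo⁺₁ (a +_) k (λ i<j _ → <⇒≢ i<j ∘ +-cancelˡ-≡ a _ _)

length-interval : ∀ a k → length (interval a k) ≡ k
length-interval a k = length-applyUpTo (a +_) k

unique-inInterval⇒length≤ : ∀ {a k xs} → Unique xs → All (InInterval a k) xs → length xs ≤ k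
unique-inInterval⇒length≤ {a} {k} {xs} unique inside = begin
  length xs              ≤⟨ unique-⊆⇒length≤ unique (∈-interval⁺ ∘ All.lookup inside) ⟩
  length (interval a k)  ≡⟨ length-interval a k ⟩
  k                      ∎
  where open ≤-Reasoning

unique-diameter⇒length≤ : ∀ {k xs} → Unique xs →
  (∀ {x y} → x ∈ xs → y ∈ xs → x ≤ y → y ∸ x < k) → length xs ≤ k
unique-diameter⇒length≤ {xs = []} _ _ = z≤n
unique-diameter⇒length≤ {k} {x ∷ xs} unique close =
  unique-inInterval⇒length≤ unique (All.tabulate fromMin)
  where
  m∈ : min x xs ∈ x ∷ xs
  m∈ = [ here , there ]′ (argmin-sel id x xs)
  fromMin : ∀ {y} → y ∈ x ∷ xs → InInterval (min x xs) k y
  fromMin y∈ = ∸<⇒inInterval m≤y (close m∈ y∈ m≤y)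
    where m≤y = All.lookup (min≤⊤ x xs All.∷ min≤xs x xs) y∈

DistancesAvoid : ℕ → ℕ → List ℕ → Set
DistancesAvoid s d xs = ∀ {x y} → x ∈ xs → y ∈ xs → x ≤ y → y ∸ x < s ⊎ d < y ∸ x

distancesAvoid-⊆ : ∀ {s d xs ys} → xs ⊆ ys → DistancesAvoid s d ys → DistancesAvoid s d xs
distancesAvoid-⊆ xs⊆ys avoid x∈ y∈ = avoid (xs⊆ys x∈) (xs⊆ys y∈)

distancesAvoid-inInterval⇒length≤ : ∀ {s d c xs} → Unique xs → DistancesAvoid s d xs →
  All (InInterval c (suc d)) xs → length xs ≤ s
distancesAvoid-inInterval⇒length≤ {s} {d} {c} {xs} unique avoid inside =
  unique-diameter⇒length≤ unique close
  where
  close : ∀ {x y} → x ∈ xs → y ∈ xs → x ≤ y → y ∸ x < s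
  close x∈ y∈ x≤y with avoid x∈ y∈ x≤y
  ... | inj₁ near = near
  ... | inj₂ far  =
    contradiction (inInterval-∸< (All.lookup inside x∈) (All.lookup inside y∈)) (≤⇒≯ far)

distancesAvoid-inInterval⇒length≤2* : ∀ {s d c xs} → Unique xs → DistancesAvoid s d xs →
  All (InInterval c (suc d + suc d)) xs → length xs ≤ 2 * s
distancesAvoid-inInterval⇒length≤2* {s} {d} {c} {xs} unique avoid inside = begin
  length xs                                          ≡⟨ length-filter-split low? xs ⟨
  length (filter low? xs) + length (filter high? xs) ≤⟨ +-mono-≤ (bound low? lowHalf)
                                                                  (bound high? highHalf) ⟩
  s + s                                              ≡⟨ m+m≡2*m s ⟩
  2 * s                                              ∎
  where
  open ≤-Reasoning
  mid = c + suc d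
  low? = _<? mid
  high? = ¬? ∘ low?
  bound : ∀ {P : ℕ → Set} (P? : ∀ x → Dec (P x)) {a} →
    (∀ {x} → x ∈ xs → P x → InInterval a (suc d) x) → length (filter P? xs) ≤ s
  bound P? half = distancesAvoid-inInterval⇒length≤ (Unique.filter⁺ P? unique)
    (distancesAvoid-⊆ (proj₁ ∘ ∈-filter⁻ P?) avoid)
    (All.tabulate (λ x∈ → let x∈xs , Px = ∈-filter⁻ P? x∈ in half x∈xs Px))
  lowHalf : ∀ {x} → x ∈ xs → x < mid → InInterval c (suc d) x
  lowHalf x∈ x<mid = proj₁ (All.lookup inside x∈) , x<mid
  highHalf : ∀ {x} → x ∈ xs → ¬ x < mid → InInterval mid (suc d) x
  highHalf {x} x∈ x≮mid =
    ≮⇒≥ x≮mid , subst (x <_) (sym (+-assoc c (suc d) (suc d))) (proj₂ (All.lookup inside x∈))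

∈-intervals⁻ : ∀ {a b s x} → x ∈ interval a s ++ interval b s →
  InInterval a s x ⊎ InInterval b s x
∈-intervals⁻ {a} {s = s} x∈ = Sum.map ∈-interval⁻ ∈-interval⁻ (∈-++⁻ (interval a s) x∈)

intervals-unique : ∀ {a b s} → a + s ≤ b → Unique (interval a s ++ interval b s)
intervals-unique {a} {b} {s} a+s≤b =
  Unique.++⁺ (interval-unique a s) (interval-unique b s) disjoint
  where
  disjoint : ∀ {x} → ¬ (x ∈ interval a s × x ∈ interval b s)
  disjoint (x∈A , x∈B) =
    <⇒≱ (<-≤-trans (proj₂ (∈-interval⁻ x∈A)) a+s≤b) (proj₁ (∈-interval⁻ x∈B))

intervals-distancesAvoid : ∀ {a b s d} → a + s + d ≤ b →
  DistancesAvoid s d (interval a s ++ interval b s)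
intervals-distancesAvoid {a} {b} {s} {d} gap {x} {y} x∈ y∈ x≤y
  with ∈-intervals⁻ x∈ | ∈-intervals⁻ y∈
... | inj₁ x∈A | inj₁ y∈A = inj₁ (inInterval-∸< x∈A y∈A)
... | inj₂ x∈B | inj₂ y∈B = inj₁ (inInterval-∸< x∈B y∈B)
... | inj₁ (_ , x<a+s) | inj₂ (b≤y , _) =
  inj₂ (+-cancelˡ-< x d (y ∸ x) (subst (x + d <_) (sym (m+[n∸m]≡n x≤y)) x+d<y))
  where
  x+d<y : x + d < y
  x+d<y = <-≤-trans (+-monoˡ-< d x<a+s) (≤-trans gap b≤y)
... | inj₂ (b≤x , _) | inj₁ (_ , y<a+s) =
  contradiction x≤y (<⇒≱ (<-≤-trans y<a+s (≤-trans (m≤m+n (a + s) d) (≤-trans gap b≤x))))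

distancesAvoid⇒noEdges : ∀ {n s₁ s₂ xs} → DistancesAvoid s₁ (n ∸ s₂) xs →
  ∀ {i j} → i ∈ xs → j ∈ xs → ¬ W-adj n s₁ s₂ i j
distancesAvoid⇒noEdges {n} {s₁} {s₂} {xs} avoid i∈ j∈ = [ noEdge i∈ j∈ , noEdge j∈ i∈ ]
  where
  noEdge : ∀ {i j} → i ∈ xs → j ∈ xs → ¬ W-adjOrd n s₁ s₂ i j
  noEdge i∈ j∈ (i<j , s₁≤j∸i , j∸i≤d) =
    [ (λ near → <⇒≱ near s₁≤j∸i) , (λ far → <⇒≱ far j∸i≤d) ]′ (avoid i∈ j∈ (<⇒≤ i<j))

noEdges⇒distancesAvoid : ∀ {n s₁ s₂ xs} → 1 ≤ s₁ →
  (∀ {i j} → i ∈ xs → j ∈ xs → ¬ W-adj n s₁ s₂ i j) → DistancesAvoid s₁ (n ∸ s₂) xs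
noEdges⇒distancesAvoid {n} {s₁} {s₂} 1≤s₁ noEdge {i} {j} i∈ j∈ _
  with j ∸ i <? s₁ | n ∸ s₂ <? j ∸ i
... | yes near | _       = inj₁ near
... | no _     | yes far = inj₂ far
... | no ¬near | no ¬far = contradiction (inj₁ (i<j , ≮⇒≥ ¬near , ≮⇒≥ ¬far)) (noEdge i∈ j∈)
  where
  i<j : i < j
  i<j = m∸n≢0⇒n<m (≢-sym (<⇒≢ (≤-trans 1≤s₁ (≮⇒≥ ¬near))))

independent⇒length≤ : ∀ n s₁ s₂ {xs} → 1 ≤ s₁ → n ≤ suc (n ∸ s₂) + suc (n ∸ s₂) →
  IsIndependent n s₁ s₂ xs → length xs ≤ 2 * s₁
independent⇒length≤ n s₁ s₂ 1≤s₁ narrow (unique , vertices , noEdge) =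
  distancesAvoid-inInterval⇒length≤2* {c = 1} unique
    (noEdges⇒distancesAvoid {n} {s₁} {s₂} 1≤s₁ noEdge)
    (All.map (λ (1≤x , x≤n) → 1≤x , s≤s (≤-trans x≤n narrow)) vertices)

intervals-independent : ∀ n s₁ s₂ → s₁ + (n ∸ s₂) + s₁ ≤ n →
  IsIndependent n s₁ s₂ (interval 1 s₁ ++ interval (1 + s₁ + (n ∸ s₂)) s₁)
intervals-independent n s₁ s₂ fits =
  intervals-unique {1} (m≤m+n (1 + s₁) (n ∸ s₂)) ,
  All.tabulate (vertex ∘ ∈-intervals⁻) ,
  distancesAvoid⇒noEdges {n} {s₁} {s₂} (intervals-distancesAvoid {1} {d = n ∸ s₂} ≤-refl)
  where
  vertex : ∀ {x} → InInterval 1 s₁ x ⊎ InInterval (1 + s₁ + (n ∸ s₂)) s₁ x → InVertexSet n x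
  vertex (inj₁ (1≤x , x<1+s₁)) =
    1≤x , ≤-trans (s≤s⁻¹ x<1+s₁) (m+n≤o⇒m≤o s₁ (m+n≤o⇒m≤o (s₁ + (n ∸ s₂)) fits))
  vertex (inj₂ (b≤x , x<b+s₁)) = ≤-trans (s≤s z≤n) b≤x , s≤s⁻¹ (≤-trans x<b+s₁ (s≤s fits))

length-intervals : ∀ a b s → length (interval a s ++ interval b s) ≡ 2 * s
length-intervals a b s = begin
  length (interval a s ++ interval b s)         ≡⟨ length-++ (interval a s) ⟩
  length (interval a s) + length (interval b s) ≡⟨ cong₂ _+_ (length-interval a s)
                                                             (length-interval b s) ⟩
  s + s                                         ≡⟨ m+m≡2*m s ⟩
  2 * s                                         ∎
  where open ≡-Reasoning

2*m∸2≤n⇒m+m≤2+n : ∀ m {n} → 2 * m ∸ 2 ≤ n → m + m ≤ 2 + n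
2*m∸2≤n⇒m+m≤2+n m {n} 2m∸2≤n = begin
  m + m           ≡⟨ m+m≡2*m m ⟩
  2 * m           ≤⟨ m≤n+m∸n (2 * m) 2 ⟩
  2 + (2 * m ∸ 2) ≤⟨ +-monoʳ-≤ 2 2m∸2≤n ⟩
  2 + n           ∎
  where open ≤-Reasoning

secondInterval-fits : ∀ n s₁ s₂ → 2 * s₁ ≤ s₂ → s₂ ≤ n → s₁ + (n ∸ s₂) + s₁ ≤ n
secondInterval-fits n s₁ s₂ 2s₁≤s₂ s₂≤n = begin
  s₁ + (n ∸ s₂) + s₁ ≡⟨ shuffle s₁ (n ∸ s₂) ⟩
  n ∸ s₂ + 2 * s₁    ≤⟨ +-monoʳ-≤ (n ∸ s₂) 2s₁≤s₂ ⟩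
  n ∸ s₂ + s₂        ≡⟨ m∸n+n≡m s₂≤n ⟩
  n                  ∎
  where
  open ≤-Reasoning
  shuffle : ∀ a d → a + d + a ≡ d + 2 * a
  shuffle = solve-∀

m+m≤2+n⇒n≤[1+n∸m]+[1+n∸m] : ∀ {m n} → m ≤ n → m + m ≤ 2 + n → n ≤ suc (n ∸ m) + suc (n ∸ m)
m+m≤2+n⇒n≤[1+n∸m]+[1+n∸m] {m} {n} m≤n m+m≤2+n = begin
  n                         ≡⟨ m∸n+n≡m m≤n ⟨
  n ∸ m + m                 ≤⟨ +-monoʳ-≤ (n ∸ m) m≤2+[n∸m] ⟩
  n ∸ m + (2 + (n ∸ m))     ≡⟨ shuffle (n ∸ m) ⟩
  suc (n ∸ m) + suc (n ∸ m) ∎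
  where
  open ≤-Reasoning
  shuffle : ∀ d → d + (2 + d) ≡ suc d + suc d
  shuffle = solve-∀
  m≤2+[n∸m] : m ≤ 2 + (n ∸ m)
  m≤2+[n∸m] = +-cancelʳ-≤ m m (2 + (n ∸ m)) (begin
    m + m           ≤⟨ m+m≤2+n ⟩
    2 + n           ≡⟨ cong (2 +_) (m∸n+n≡m m≤n) ⟨
    2 + (n ∸ m + m) ≡⟨ +-assoc 2 (n ∸ m) m ⟨
    2 + (n ∸ m) + m ∎)

lemma6 : (n s₁ s₂ : ℕ) → 1 ≤ n → 1 ≤ s₁ → 1 ≤ s₂ →
    2 * s₁ ≤ s₂ → 2 * s₂ ∸ 2 ≤ n →
    IndependenceNumberIs n s₁ s₂ (2 * s₁)
lemma6 n s₁ s₂ _ 1≤s₁ _ 2s₁≤s₂ 2s₂∸2≤n =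
  ( _
  , intervals-independent n s₁ s₂ (secondInterval-fits n s₁ s₂ 2s₁≤s₂ s₂≤n)
  , length-intervals 1 _ s₁ )
  , λ _ → independent⇒length≤ n s₁ s₂ 1≤s₁ narrow
  where
  s₂+s₂≤2+n : s₂ + s₂ ≤ 2 + n
  s₂+s₂≤2+n = 2*m∸2≤n⇒m+m≤2+n s₂ 2s₂∸2≤n
  2≤s₂ : 2 ≤ s₂
  2≤s₂ = ≤-trans (*-monoʳ-≤ 2 1≤s₁) 2s₁≤s₂
  s₂≤n : s₂ ≤ n
  s₂≤n = +-cancelˡ-≤ 2 s₂ n (≤-trans (+-monoˡ-≤ s₂ 2≤s₂) s₂+s₂≤2+n)
  narrow : n ≤ suc (n ∸ s₂) + suc (n ∸ s₂)
  narrow = m+m≤2+n⇒n≤[1+n∸m]+[1+n∸m] s₂≤n s₂+s₂≤2+n
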